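{- Let $G$ be a graph and let $l$ be an intersecting supermodular real function on subsets of $V(G)$. If $\beta\ge1$ is a real number, then $$l(G)\le \Theta_l(G)\le \frac{1}{\beta}\Theta_{\beta l}(G).$$ Furthermore, $G$ is $l$-partition-connected if and only if $\Theta_l(G)=l(G)$.
   Context: Graphs are finite, loopless, and may have multiple edges. $l(\emptyset)=0$, $l(G)=l(V(G))$. $l$ is intersecting supermodular if $l(A\cap B)+l(A\cup B)\ge l(A)+l(B)$ whenever $A\cap B\neq\emptyset$. For a partition $P$ of $V(K)$, $e_K(P)$ is the number of edges joining different parts. $K$ is $l$-partition-connected if $e_K(P)\ge\sum_{A\in P}l(A)-l(V(K))$ for all partitions $P$ of $V(K)$. For intersecting supermodular $l$, $V(K)$ is uniquely partitioned into the maximal sets $Y$ with $K[Y]$ $l$-partition-connected (the $l$-partition-connected components), and $\Theta_l(K)=\sum_{A\in P}l(A)-e_K(P)$ for this partition $P$. $\beta l$ denotes the function $A\mapsto\beta l(A)$. -}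

module Defs where

open import Level using (0ℓ)
open import Data.Nat as ℕ using (ℕ; zero; suc)
open import Data.Fin using (Fin; zero; suc; _≟_)
open import Data.Fin.Subset using (Subset; _∩_; _∪_; _⊆_; ⊥; ⊤; Nonempty)
open import Data.Bool using (Bool; true; false; _∧_; not; if_then_else_)
open import Data.Vec using (lookup; tabulate)
open import Data.List using (List; []; _∷_)
open import Data.List.Relation.Unary.All using (All)
open import Data.Product using (Σ; ∃; _×_; _,_; proj₁; proj₂)
open import Relation.Nullary using (¬_)
open import Relation.Nullary.Decidable using (⌊_⌋)
open import Relation.Binary.PropositionalEquality using (_≡_; _≢_)
open import Relation.Binary.Structures using (IsTotalOrder)
open import Algebra.Structures using (IsCommutativeRing)

-- The real numbers, axiomatised as a complete ordered field
-- (unique up to isomorphism, so quantifying over all such structures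
-- is the same as speaking about ℝ).

record CompleteOrderedField : Set₁ where
  infixl 6 _+_ _-_
  infixl 7 _*_
  infix 4 _≤_
  field
    ℝ   : Set
    _+_ _*_ : ℝ → ℝ → ℝ
    -_  : ℝ → ℝ
    0r 1r : ℝ
    _⁻¹ : ℝ → ℝ           -- total; only meaningful on nonzero arguments
    _≤_ : ℝ → ℝ → Set
    isCommutativeRing : IsCommutativeRing _≡_ _+_ _*_ -_ 0r 1r
    0≢1 : 0r ≢ 1r
    ⁻¹-inverse : ∀ x → x ≢ 0r → x * (x ⁻¹) ≡ 1r
    isTotalOrder : IsTotalOrder _≡_ _≤_
    +-mono-≤ : ∀ {x y} z → x ≤ y → x + z ≤ y + z
    *-nonneg : ∀ {x y} → 0r ≤ x → 0r ≤ y → 0r ≤ x * y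
    complete : (S : ℝ → Set) → (∃ λ x → S x) →
               (∃ λ b → ∀ x → S x → x ≤ b) →
               ∃ λ s → (∀ x → S x → x ≤ s) ×
                       (∀ b → (∀ x → S x → x ≤ b) → s ≤ b)

  _-_ : ℝ → ℝ → ℝ
  x - y = x + (- y)

  fromℕ : ℕ → ℝ
  fromℕ zero    = 0r
  fromℕ (suc n) = 1r + fromℕ n

  sumF : (k : ℕ) → (Fin k → ℝ) → ℝ
  sumF zero    f = 0r
  sumF (suc k) f = f zero + sumF k (λ i → f (suc i))

-- Finite loopless multigraphs on vertex set Fin n

record Graph (n : ℕ) : Set where
  field
    edges    : List (Fin n × Fin n)
    loopless : All (λ e → proj₁ e ≢ proj₂ e) edges
open Graph public

countE : ∀ {n} → (Fin n → Fin n → Bool) → List (Fin n × Fin n) → ℕ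
countE P []             = 0
countE P ((u , v) ∷ es) = (if P u v then 1 else 0) ℕ.+ countE P es

-- Partitions of a vertex subset Y ⊆ Fin n into k parts, given by a
-- labelling p : Fin n → Fin k (only labels of vertices of Y matter);
-- every part must be nonempty.

record Partition {n : ℕ} (Y : Subset n) : Set where
  field
    k     : ℕ
    label : Fin n → Fin k
  part : Fin k → Subset n
  part i = tabulate (λ v → lookup Y v ∧ ⌊ label v ≟ i ⌋)
  field
    partNonempty : ∀ i → Nonempty (part i)
open Partition public

crossing : ∀ {n} (G : Graph n) {Y : Subset n} → Partition Y → ℕ
crossing G {Y} P =
  countE (λ u v → lookup Y u ∧ lookup Y v ∧ not ⌊ label P u ≟ label P v ⌋)
         (edges G)

module _ (R : CompleteOrderedField) where
  open CompleteOrderedField R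

  SetFn : ℕ → Set
  SetFn n = Subset n → ℝ

  IntersectingSupermodular : ∀ {n} → SetFn n → Set
  IntersectingSupermodular l =
    ∀ A B → Nonempty (A ∩ B) → l A + l B ≤ l (A ∩ B) + l (A ∪ B)

  scale : ∀ {n} → ℝ → SetFn n → SetFn n
  scale β l A = β * l A

  sumParts : ∀ {n} {Y : Subset n} → SetFn n → Partition Y → ℝ
  sumParts l P = sumF (k P) (λ i → l (part P i))

  PartitionConnectedOn : ∀ {n} → Graph n → SetFn n → Subset n → Set
  PartitionConnectedOn G l Y =
    (P : Partition Y) → sumParts l P - l Y ≤ fromℕ (crossing G P)

  PartitionConnected : ∀ {n} → Graph n → SetFn n → Set
  PartitionConnected G l = PartitionConnectedOn G l ⊤

  -- P is the partition of V(G) into l-partition-connected components: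
  -- each part induces an l-partition-connected subgraph, and every
  -- nonempty Y with G[Y] l-partition-connected lies inside some part
  -- (so the parts are exactly the maximal such sets).
  IsComponentPartition : ∀ {n} → Graph n → SetFn n → Partition {n} ⊤ → Set
  IsComponentPartition G l P =
    (∀ i → PartitionConnectedOn G l (part P i)) ×
    (∀ Y → Nonempty Y → PartitionConnectedOn G l Y →
       ∃ λ i → Y ⊆ part P i)

  -- Θ_l(G) computed from the component partition P
  Θ : ∀ {n} → Graph n → SetFn n → Partition {n} ⊤ → ℝ
  Θ G l P = sumParts l P - fromℕ (crossing G P)

-- For a labelling h : V → Fin m and a vertex set Y, let θ_Y(h) be the sum of l over the blocks
-- h⁻¹(j) ∩ Y minus the number of edges of G[Y] whose ends get different labels; a partition of Y
-- is a labelling without empty blocks, and empty blocks cost nothing since l ∅ = 0.  Θ_l(G) is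
-- the maximum of θ_V over all labellings.  Take a maximising labelling g (finitely many labellings
-- matter, as a partition has at most |V| parts).  Splitting a block B of g along a partition Ω of
-- B changes θ_V by θ_B(Ω) − l(B), so maximality makes every block of g l-partition-connected,
-- hence contained in an l-partition-connected component.  Since g refines the component
-- partition P, θ_V(g) is the sum of θ over the components minus the edges between them, and each
-- component A contributes at most l(A); so θ_V(g) ≤ Θ_l(G).  The three claims follow by comparing
-- Θ_l(G) with the trivial labelling, with P evaluated for βl, and with an arbitrary partition.
-- Intersecting supermodularity only serves to make the component partitions exist, which the
-- statement assumes.

module Submission where

open import Level using (0ℓ)
open import Function using (_∘_)
open import Function.Bundles using (_⇔_; mk⇔)
open import Function.Definitions using (Injective)
open import Data.Empty using (⊥-elim)
open import Data.Product using (_×_; _,_; proj₁; proj₂; ∃)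
open import Data.Sum using (_⊎_; inj₁; inj₂)
open import Data.Sum.Properties using (inj₁-injective; inj₂-injective)
open import Data.Bool using (Bool; true; false; _∧_; not; if_then_else_)
open import Data.Bool.Properties using (∧-zeroʳ; ∧-identityʳ; ∧-assoc)
open import Data.Nat as ℕ using (ℕ; zero; suc)
import Data.Nat.Properties as ℕ
open import Data.Fin using (Fin; zero; suc; _≟_; inject≤; punchIn; punchOut; join; splitAt)
open import Data.Fin.Properties
  using (inject≤-injective; punchInᵢ≢i; punchIn-injective; punchIn-punchOut; splitAt-join
        ; any?; all?; ¬∀⟶∃¬; pigeonhole; <-irrefl)
open import Data.Fin.Subset using (Subset; _∈_; _⊆_; ⊤; ⊥; Nonempty; Empty)
open import Data.Fin.Subset.Properties using (∈⊤; Empty-unique; ⊆-antisym; nonempty?)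
open import Data.List using ([]; _∷_)
open import Data.Vec using (lookup; tabulate)
open import Data.Vec.Properties using (lookup∘tabulate; tabulate-cong; []=⇒lookup; lookup⇒[]=)
open import Data.Vec.Functional as Vector using (removeAt)
open import Relation.Nullary using (¬_; yes; no; Dec)
open import Relation.Nullary.Decidable using (⌊_⌋; dec-true; dec-false; isYes≗does; does-⇔)
open import Relation.Binary.PropositionalEquality
open import Relation.Binary.Structures using (IsTotalOrder)
open import Relation.Binary.Bundles using (TotalOrder)
open import Algebra.Bundles using (CommutativeRing)
import Algebra.Properties.Ring as RingProperties
import Algebra.Properties.Semiring.Sum as SemiringSum
import Algebra.Solver.CommutativeMonoid as CommutativeMonoidSolver
open import Algebra.Properties.CommutativeSemigroup ℕ.+-commutativeSemigroup
  using () renaming (interchange to ℕ-interchange)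

open import Defs

module OrderedFieldProperties (R : CompleteOrderedField) where
  open CompleteOrderedField R

  commutativeRing : CommutativeRing 0ℓ 0ℓ
  commutativeRing = record { isCommutativeRing = isCommutativeRing }

  totalOrder : TotalOrder 0ℓ 0ℓ 0ℓ
  totalOrder = record { isTotalOrder = isTotalOrder }

  open CommutativeRing commutativeRing public
    using ( +-comm; +-assoc; +-identityˡ; +-identityʳ; -‿inverseˡ; -‿inverseʳ
          ; *-comm; *-assoc; *-identityˡ; *-identityʳ; distribˡ; zeroʳ
          ; +-commutativeMonoid; semiring )
  open RingProperties (CommutativeRing.ring commutativeRing) public
    using (-‿distribʳ-*; -‿involutive; -0#≈0#; -‿+-comm)
  open IsTotalOrder isTotalOrder public
    using (total; antisym) renaming (refl to ≤-refl; trans to ≤-trans)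

  +-monoʳ-≤ : ∀ {x y} z → x ≤ y → z + x ≤ z + y
  +-monoʳ-≤ {x} {y} z x≤y = subst₂ _≤_ (+-comm x z) (+-comm y z) (+-mono-≤ z x≤y)

  +-mono₂-≤ : ∀ {a b c d} → a ≤ b → c ≤ d → a + c ≤ b + d
  +-mono₂-≤ {b = b} {c} a≤b c≤d = ≤-trans (+-mono-≤ c a≤b) (+-monoʳ-≤ b c≤d)

  x+y-y≡x : ∀ x y → x + y - y ≡ x
  x+y-y≡x x y = trans (+-assoc x y (- y)) (trans (cong (x +_) (-‿inverseʳ y)) (+-identityʳ x))

  x-y+y≡x : ∀ x y → x - y + y ≡ x
  x-y+y≡x x y = trans (+-assoc x (- y) y) (trans (cong (x +_) (-‿inverseˡ y)) (+-identityʳ x))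

  +-cancelʳ-≤ : ∀ {x y} z → x + z ≤ y + z → x ≤ y
  +-cancelʳ-≤ {x} {y} z p = subst₂ _≤_ (x+y-y≡x x z) (x+y-y≡x y z) (+-mono-≤ (- z) p)

  +-cancelˡ-≤ : ∀ {x y} z → z + x ≤ z + y → x ≤ y
  +-cancelˡ-≤ {x} {y} z p = +-cancelʳ-≤ z (subst₂ _≤_ (+-comm z x) (+-comm z y) p)

  x-y≤z⇒x≤z+y : ∀ {x y z} → x - y ≤ z → x ≤ z + y
  x-y≤z⇒x≤z+y {x} {y} p = subst (_≤ _) (x-y+y≡x x y) (+-mono-≤ y p)

  x≤y+z⇒x-y≤z : ∀ {x y z} → x ≤ y + z → x - y ≤ z
  x≤y+z⇒x-y≤z {x} {y} {z} p =
    subst (x - y ≤_) (trans (cong (_- y) (+-comm y z)) (x+y-y≡x z y)) (+-mono-≤ (- y) p)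

  x-y≤z⇒x-z≤y : ∀ {x y z} → x - y ≤ z → x - z ≤ y
  x-y≤z⇒x-z≤y p = x≤y+z⇒x-y≤z (x-y≤z⇒x≤z+y p)

  -‿antitone : ∀ {x y} → x ≤ y → - y ≤ - x
  -‿antitone {x} {y} p = subst₂ _≤_ lhs rhs (+-mono-≤ (- x + - y) p)
    where
    lhs : x + (- x + - y) ≡ - y
    lhs = trans (sym (+-assoc x (- x) (- y)))
                (trans (cong (_+ - y) (-‿inverseʳ x)) (+-identityˡ (- y)))
    rhs : y + (- x + - y) ≡ - x
    rhs = trans (cong (y +_) (+-comm (- x) (- y))) (trans (sym (+-assoc y (- y) (- x)))
                (trans (cong (_+ - x) (-‿inverseʳ y)) (+-identityˡ (- x))))

  0≤-x⇒x≤0 : ∀ {x} → 0r ≤ - x → x ≤ 0r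
  0≤-x⇒x≤0 {x} p = subst₂ _≤_ (-‿involutive x) -0#≈0# (-‿antitone p)

  0≤1 : 0r ≤ 1r
  0≤1 with total 0r 1r
  ... | inj₁ 0≤1 = 0≤1
  ... | inj₂ 1≤0 = subst (0r ≤_) [-1]*[-1]≡1 (*-nonneg 0≤-1 0≤-1)
    where
    0≤-1 : 0r ≤ - 1r
    0≤-1 = subst (_≤ - 1r) -0#≈0# (-‿antitone 1≤0)
    [-1]*[-1]≡1 : - 1r * - 1r ≡ 1r
    [-1]*[-1]≡1 = trans (sym (-‿distribʳ-* (- 1r) 1r))
                        (trans (cong -_ (*-identityʳ (- 1r))) (-‿involutive 1r))

  1≰0 : ¬ (1r ≤ 0r)
  1≰0 1≤0 = 0≢1 (antisym 0≤1 1≤0)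

  fromℕ-nonneg : ∀ m → 0r ≤ fromℕ m
  fromℕ-nonneg zero    = ≤-refl
  fromℕ-nonneg (suc m) =
    subst (_≤ 1r + fromℕ m) (+-identityˡ 0r) (+-mono₂-≤ 0≤1 (fromℕ-nonneg m))

  fromℕ-+ : ∀ a b → fromℕ (a ℕ.+ b) ≡ fromℕ a + fromℕ b
  fromℕ-+ zero    b = sym (+-identityˡ (fromℕ b))
  fromℕ-+ (suc a) b = trans (cong (1r +_) (fromℕ-+ a b)) (sym (+-assoc 1r (fromℕ a) (fromℕ b)))

  *-monoˡ-≤-nonneg : ∀ {x y} z → 0r ≤ z → x ≤ y → z * x ≤ z * y
  *-monoˡ-≤-nonneg {x} {y} z 0≤z x≤y =
    subst₂ _≤_ (+-identityˡ (z * x)) (x-y+y≡x (z * y) (z * x)) (+-mono-≤ (z * x) 0≤zy-zx)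
    where
    0≤y-x : 0r ≤ y - x
    0≤y-x = subst (_≤ y - x) (-‿inverseʳ x) (+-mono-≤ (- x) x≤y)
    0≤zy-zx : 0r ≤ z * y - z * x
    0≤zy-zx = subst (0r ≤_) (trans (distribˡ z y (- x)) (cong (z * y +_) (sym (-‿distribʳ-* z x))))
                (*-nonneg 0≤z 0≤y-x)

  module _ {x : ℝ} (1≤x : 1r ≤ x) where
    private
      0≤x : 0r ≤ x
      0≤x = ≤-trans 0≤1 1≤x
      x*x⁻¹≡1 : x * x ⁻¹ ≡ 1r
      x*x⁻¹≡1 = ⁻¹-inverse x (λ x≡0 → 1≰0 (subst (1r ≤_) x≡0 1≤x))

    0≤x⁻¹ : 0r ≤ x ⁻¹
    0≤x⁻¹ with total 0r (x ⁻¹)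
    ... | inj₁ p     = p
    ... | inj₂ x⁻¹≤0 =
      ⊥-elim (1≰0 (0≤-x⇒x≤0 (subst (0r ≤_) x*-x⁻¹≡-1 (*-nonneg 0≤x 0≤-x⁻¹))))
      where
      0≤-x⁻¹ : 0r ≤ - (x ⁻¹)
      0≤-x⁻¹ = subst (_≤ - (x ⁻¹)) -0#≈0# (-‿antitone x⁻¹≤0)
      x*-x⁻¹≡-1 : x * - (x ⁻¹) ≡ - 1r
      x*-x⁻¹≡-1 = trans (sym (-‿distribʳ-* x (x ⁻¹))) (cong -_ x*x⁻¹≡1)

    x⁻¹≤1 : x ⁻¹ ≤ 1r
    x⁻¹≤1 = subst₂ _≤_ (*-identityʳ (x ⁻¹)) (trans (*-comm (x ⁻¹) x) x*x⁻¹≡1)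
              (*-monoˡ-≤-nonneg (x ⁻¹) 0≤x⁻¹ 1≤x)

    x⁻¹-scaling : ∀ {a c t} → 0r ≤ c → x * a - c ≤ t → a - c ≤ x ⁻¹ * t
    x⁻¹-scaling {a} {c} {t} 0≤c xa-c≤t =
      ≤-trans (+-monoʳ-≤ a (-‿antitone x⁻¹c≤c))
              (subst (_≤ x ⁻¹ * t) x⁻¹[xa-c]≡a-x⁻¹c (*-monoˡ-≤-nonneg (x ⁻¹) 0≤x⁻¹ xa-c≤t))
      where
      x⁻¹c≤c : x ⁻¹ * c ≤ c
      x⁻¹c≤c = subst₂ _≤_ (*-comm c (x ⁻¹)) (*-identityʳ c) (*-monoˡ-≤-nonneg c 0≤c x⁻¹≤1)
      x⁻¹[xa-c]≡a-x⁻¹c : x ⁻¹ * (x * a - c) ≡ a - x ⁻¹ * c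
      x⁻¹[xa-c]≡a-x⁻¹c = begin
        x ⁻¹ * (x * a - c)
          ≡⟨ distribˡ (x ⁻¹) (x * a) (- c) ⟩
        x ⁻¹ * (x * a) + x ⁻¹ * - c
          ≡⟨ cong₂ _+_ (sym (*-assoc (x ⁻¹) x a)) (sym (-‿distribʳ-* (x ⁻¹) c)) ⟩
        x ⁻¹ * x * a - x ⁻¹ * c
          ≡⟨ cong (λ y → y * a - x ⁻¹ * c) (trans (*-comm (x ⁻¹) x) x*x⁻¹≡1) ⟩
        1r * a - x ⁻¹ * c
          ≡⟨ cong (_- x ⁻¹ * c) (*-identityˡ a) ⟩
        a - x ⁻¹ * c ∎
        where open ≡-Reasoning

⌊⌋-true : ∀ {a} {A : Set a} (a? : Dec A) → A → ⌊ a? ⌋ ≡ true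
⌊⌋-true a? a = trans (isYes≗does a?) (dec-true a? a)

⌊⌋-false : ∀ {a} {A : Set a} (a? : Dec A) → ¬ A → ⌊ a? ⌋ ≡ false
⌊⌋-false a? ¬a = trans (isYes≗does a?) (dec-false a? ¬a)

⌊⌋-⇔ : ∀ {a b} {A : Set a} {B : Set b} → A ⇔ B → (a? : Dec A) (b? : Dec B) → ⌊ a? ⌋ ≡ ⌊ b? ⌋
⌊⌋-⇔ A⇔B a? b? = trans (isYes≗does a?) (trans (does-⇔ A⇔B a? b?) (sym (isYes≗does b?)))

∧-congˡ-true : ∀ {a b c : Bool} → (a ≡ true → b ≡ c) → a ∧ b ≡ a ∧ c
∧-congˡ-true {false} _   = refl
∧-congˡ-true {true}  b≡c = b≡c refl

join-injective : ∀ m n → Injective _≡_ _≡_ (join m n)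
join-injective m n {x} {y} e =
  trans (sym (splitAt-join m n x)) (trans (cong (splitAt m) e) (splitAt-join m n y))

𝟙 : Bool → ℕ
𝟙 b = if b then 1 else 0

module _ {n : ℕ} where

  countE-cong : ∀ {P Q : Fin n → Fin n → Bool} es →
    (∀ u v → P u v ≡ Q u v) → countE P es ≡ countE Q es
  countE-cong []             P≡Q = refl
  countE-cong ((u , v) ∷ es) P≡Q = cong₂ (λ b c → 𝟙 b ℕ.+ c) (P≡Q u v) (countE-cong es P≡Q)

  countE-+ : ∀ {P Q S : Fin n → Fin n → Bool} es →
    (∀ u v → 𝟙 (S u v) ≡ 𝟙 (P u v) ℕ.+ 𝟙 (Q u v)) → countE S es ≡ countE P es ℕ.+ countE Q es
  countE-+ []             S≡P+Q = refl
  countE-+ {P} {Q} {S} ((u , v) ∷ es) S≡P+Q = begin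
    𝟙 (S u v) ℕ.+ countE S es
      ≡⟨ cong₂ ℕ._+_ (S≡P+Q u v) (countE-+ es S≡P+Q) ⟩
    (𝟙 (P u v) ℕ.+ 𝟙 (Q u v)) ℕ.+ (countE P es ℕ.+ countE Q es)
      ≡⟨ ℕ-interchange (𝟙 (P u v)) _ _ _ ⟩
    (𝟙 (P u v) ℕ.+ countE P es) ℕ.+ (𝟙 (Q u v) ℕ.+ countE Q es) ∎
    where open ≡-Reasoning

  countE-false : ∀ {P : Fin n → Fin n → Bool} es → (∀ u v → P u v ≡ false) → countE P es ≡ 0
  countE-false []                 P≡false = refl
  countE-false {P} ((u , v) ∷ es) P≡false =
    trans (cong (λ b → 𝟙 b ℕ.+ countE P es) (P≡false u v)) (countE-false es P≡false)

module FiniteSums (R : CompleteOrderedField) where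
  open CompleteOrderedField R
  open OrderedFieldProperties R
  open SemiringSum semiring public
    using (sum; sum-cong-≗; sum-replicate-zero; sum-remove; ∑-distrib-+; ∑-comm; *-distribˡ-sum)
  open CommutativeMonoidSolver +-commutativeMonoid using (solve; _⊕_; _⊜_)

  sumF≡sum : ∀ k (f : Fin k → ℝ) → sumF k f ≡ sum f
  sumF≡sum zero    f = refl
  sumF≡sum (suc k) f = cong (f zero +_) (sumF≡sum k (f ∘ suc))

  sum-zero : ∀ {k} {f : Fin k → ℝ} → (∀ i → f i ≡ 0r) → sum f ≡ 0r
  sum-zero {k} f≗0 = trans (sum-cong-≗ f≗0) (sum-replicate-zero k)

  sum-single : ∀ {k} {f : Fin k → ℝ} i → (∀ j → j ≢ i → f j ≡ 0r) → sum f ≡ f i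
  sum-single {suc k} {f} i others≡0 = begin
    sum f
      ≡⟨ sum-remove f ⟩
    f i + sum (removeAt f i)
      ≡⟨ cong (f i +_) (sum-zero (λ j → others≡0 (punchIn i j) (punchInᵢ≢i i j))) ⟩
    f i + 0r
      ≡⟨ +-identityʳ (f i) ⟩
    f i ∎
    where open ≡-Reasoning

  sum-update : ∀ {k} {f g : Fin k → ℝ} i → (∀ j → j ≢ i → f j ≡ g j) →
    sum f + g i ≡ sum g + f i
  sum-update {suc k} {f} {g} i f≡g = begin
    sum f + g i
      ≡⟨ cong (_+ g i) (sum-remove f) ⟩
    f i + sum (removeAt f i) + g i
      ≡⟨ cong (λ s → f i + s + g i) (sum-cong-≗ (λ j → f≡g (punchIn i j) (punchInᵢ≢i i j))) ⟩
    f i + sum (removeAt g i) + g i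
      ≡⟨ solve 3 (λ a s b → (a ⊕ s) ⊕ b ⊜ (b ⊕ s) ⊕ a) refl (f i) (sum (removeAt g i)) (g i) ⟩
    g i + sum (removeAt g i) + f i
      ≡⟨ cong (_+ f i) (sum-remove g) ⟨
    sum g + f i ∎
    where open ≡-Reasoning

  sum-mono-≤ : ∀ {k} {f g : Fin k → ℝ} → (∀ i → f i ≤ g i) → sum f ≤ sum g
  sum-mono-≤ {zero}  f≤g = ≤-refl
  sum-mono-≤ {suc k} f≤g = +-mono₂-≤ (f≤g zero) (sum-mono-≤ (f≤g ∘ suc))

  ∑-distrib-neg : ∀ {k} (f : Fin k → ℝ) → sum (λ i → - f i) ≡ - sum f
  ∑-distrib-neg {zero}  f = sym -0#≈0#
  ∑-distrib-neg {suc k} f =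
    trans (cong (- f zero +_) (∑-distrib-neg (f ∘ suc))) (-‿+-comm (f zero) (sum (f ∘ suc)))

  ∑-reindex-injective : ∀ {k m} (f : Fin k → Fin m) → Injective _≡_ _≡_ f →
    (g : Fin m → ℝ) → (∀ j → (∀ i → f i ≢ j) → g j ≡ 0r) → sum g ≡ sum (g ∘ f)
  ∑-reindex-injective {k} {m} f f-inj g g≡0 = begin
    sum g                          ≡⟨ sum-cong-≗ g≡∑δ ⟩
    sum (λ j → sum (λ i → δ i j))  ≡⟨ ∑-comm δ ⟨
    sum (λ i → sum (λ j → δ i j))  ≡⟨ sum-cong-≗ (λ i → trans (sum-single (f i) (δ≡0 i)) (δ-diag i)) ⟩
    sum (g ∘ f)                    ∎
    where
    open ≡-Reasoning
    δ : Fin k → Fin m → ℝ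
    δ i j = if ⌊ f i ≟ j ⌋ then g j else 0r
    δ≡0 : ∀ i j → j ≢ f i → δ i j ≡ 0r
    δ≡0 i j j≢fi with f i ≟ j
    ... | yes fi≡j = ⊥-elim (j≢fi (sym fi≡j))
    ... | no _     = refl
    δ-diag : ∀ i → δ i (f i) ≡ g (f i)
    δ-diag i with f i ≟ f i
    ... | yes _    = refl
    ... | no fi≢fi = ⊥-elim (fi≢fi refl)
    g≡∑δ : ∀ j → g j ≡ sum (λ i → δ i j)
    g≡∑δ j with any? (λ i → f i ≟ j)
    ... | yes (i , refl) =
      sym (trans (sum-single i (λ i′ i′≢i → δ≡0 i′ (f i) (i′≢i ∘ f-inj ∘ sym))) (δ-diag i))
    ... | no ∄i =
      trans (g≡0 j (λ i fi≡j → ∄i (i , fi≡j)))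
            (sym (sum-zero (λ i → δ≡0 i j (λ j≡fi → ∄i (i , sym j≡fi)))))

  ∑-fromℕ-countE : ∀ {n K} (P : Fin K → Fin n → Fin n → Bool) (Q : Fin n → Fin n → Bool) es →
    (∀ u v → sum (λ j → fromℕ (𝟙 (P j u v))) ≡ fromℕ (𝟙 (Q u v))) →
    sum (λ j → fromℕ (countE (P j) es)) ≡ fromℕ (countE Q es)
  ∑-fromℕ-countE {K = K} P Q []     P≡Q = sum-zero {K} (λ _ → refl)
  ∑-fromℕ-countE P Q ((u , v) ∷ es) P≡Q = begin
    sum (λ j → fromℕ (𝟙 (P j u v) ℕ.+ countE (P j) es))
      ≡⟨ sum-cong-≗ (λ j → fromℕ-+ (𝟙 (P j u v)) (countE (P j) es)) ⟩
    sum (λ j → fromℕ (𝟙 (P j u v)) + fromℕ (countE (P j) es))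
      ≡⟨ ∑-distrib-+ (λ j → fromℕ (𝟙 (P j u v))) (λ j → fromℕ (countE (P j) es)) ⟩
    sum (λ j → fromℕ (𝟙 (P j u v))) + sum (λ j → fromℕ (countE (P j) es))
      ≡⟨ cong₂ _+_ (P≡Q u v) (∑-fromℕ-countE P Q es P≡Q) ⟩
    fromℕ (𝟙 (Q u v)) + fromℕ (countE Q es)
      ≡⟨ fromℕ-+ (𝟙 (Q u v)) (countE Q es) ⟨
    fromℕ (𝟙 (Q u v) ℕ.+ countE Q es) ∎
    where open ≡-Reasoning

module Maximisation {c ℓ₁ ℓ₂} (O : TotalOrder c ℓ₁ ℓ₂) where
  open TotalOrder O
    using (Carrier; _≈_; _≤_; total; reflexive) renaming (refl to ≤-refl; trans to ≤-trans)

  argmax-Fin : ∀ {m} (f : Fin (suc m) → Carrier) → ∃ λ i → ∀ j → f j ≤ f i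
  argmax-Fin {zero}  f = zero , λ { zero → ≤-refl }
  argmax-Fin {suc m} f with argmax-Fin (f ∘ suc)
  ... | i , fsuc≤ with total (f zero) (f (suc i))
  ...   | inj₁ f0≤ = suc i , λ { zero → f0≤ ; (suc j) → fsuc≤ j }
  ...   | inj₂ ≤f0 = zero , λ { zero → ≤-refl ; (suc j) → ≤-trans (fsuc≤ j) ≤f0 }

  argmax-→ : ∀ {a m} (F : (Fin a → Fin (suc m)) → Carrier) → (∀ {g g′} → g ≗ g′ → F g ≈ F g′) →
    ∃ λ g → ∀ g′ → F g′ ≤ F g
  argmax-→ {zero}      F F-cong = (λ ()) , λ g′ → reflexive (F-cong (λ ()))
  argmax-→ {suc a} {m} F F-cong = x* Vector.∷ best x* , bound
    where
    Fₓ : Fin (suc m) → (Fin a → Fin (suc m)) → Carrier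
    Fₓ x h = F (x Vector.∷ h)
    maxₓ : ∀ x → ∃ λ h → ∀ h′ → Fₓ x h′ ≤ Fₓ x h
    maxₓ x = argmax-→ (Fₓ x) (λ h≗h′ → F-cong λ { zero → refl ; (suc i) → h≗h′ i })
    best : Fin (suc m) → Fin a → Fin (suc m)
    best x = proj₁ (maxₓ x)
    x* : Fin (suc m)
    x* = proj₁ (argmax-Fin (λ x → Fₓ x (best x)))
    bound : ∀ g′ → F g′ ≤ F (x* Vector.∷ best x*)
    bound g′ = ≤-trans (reflexive (F-cong λ { zero → refl ; (suc i) → refl }))
                 (≤-trans (proj₂ (maxₓ (g′ zero)) (g′ ∘ suc))
                          (proj₂ (argmax-Fin (λ x → Fₓ x (best x))) (g′ zero)))

module Blocks {n : ℕ} where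

  block : ∀ {m} → Subset n → (Fin n → Fin m) → Fin m → Subset n
  block Y h j = tabulate (λ v → lookup Y v ∧ ⌊ h v ≟ j ⌋)

  ∈-block⁺ : ∀ {m} {Y} {h : Fin n → Fin m} {j v} → v ∈ Y → h v ≡ j → v ∈ block Y h j
  ∈-block⁺ {Y = Y} {h} {j} {v} v∈Y hv≡j = lookup⇒[]= v _ (begin
    lookup (block Y h j) v  ≡⟨ lookup∘tabulate _ v ⟩
    lookup Y v ∧ ⌊ h v ≟ j ⌋  ≡⟨ cong₂ _∧_ ([]=⇒lookup v∈Y) (⌊⌋-true (h v ≟ j) hv≡j) ⟩
    true                      ∎)
    where open ≡-Reasoning

  ∈-block⁻ : ∀ {m} Y (h : Fin n → Fin m) {j v} → v ∈ block Y h j → v ∈ Y × h v ≡ j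
  ∈-block⁻ Y h {j} {v} v∈B
    with lookup Y v in Yv | h v ≟ j | trans (sym (lookup∘tabulate _ v)) ([]=⇒lookup v∈B)
  ... | true | yes hv≡j | _ = lookup⇒[]= v Y Yv , hv≡j

  block-empty : ∀ {m} Y (h : Fin n → Fin m) {j} → (∀ {v} → v ∈ Y → h v ≢ j) → block Y h j ≡ ⊥
  block-empty Y h hv≢j =
    Empty-unique (λ (v , v∈B) → let (v∈Y , hv≡j) = ∈-block⁻ Y h v∈B in hv≢j v∈Y hv≡j)

  parts≤n : ∀ {Y : Subset n} (P : Partition Y) → k P ℕ.≤ n
  parts≤n {Y} P with k P ℕ.≤? n
  ... | yes k≤n = k≤n
  ... | no  k≰n with pigeonhole (ℕ.≰⇒> k≰n) (proj₁ ∘ partNonempty P)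
  ...   | (i , j , i<j , wᵢ≡wⱼ) = ⊥-elim (<-irrefl i≡j i<j)
    where
    label-witness : ∀ i → label P (proj₁ (partNonempty P i)) ≡ i
    label-witness i = proj₂ (∈-block⁻ Y (label P) (proj₂ (partNonempty P i)))
    i≡j : i ≡ j
    i≡j = trans (sym (label-witness i)) (trans (cong (label P) wᵢ≡wⱼ) (label-witness j))

  _Refines_ : ∀ {M K} → (Fin n → Fin M) → (Fin n → Fin K) → Set
  q Refines p = ∀ u v → q u ≡ q v → p u ≡ p v

module Cuts {n : ℕ} (G : Graph n) where

  cut : ∀ {m} → Subset n → (Fin n → Fin m) → ℕ
  cut Y h = countE (λ u v → lookup Y u ∧ lookup Y v ∧ not ⌊ h u ≟ h v ⌋) (edges G)

  cut-cong : ∀ {m m′} {Y} {h : Fin n → Fin m} {h′ : Fin n → Fin m′} →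
    (∀ {u v} → u ∈ Y → v ∈ Y → ⌊ h u ≟ h v ⌋ ≡ ⌊ h′ u ≟ h′ v ⌋) → cut Y h ≡ cut Y h′
  cut-cong {Y = Y} same = countE-cong (edges G) λ u v →
    ∧-congˡ-true λ Yu → ∧-congˡ-true λ Yv →
      cong not (same (lookup⇒[]= u Y Yu) (lookup⇒[]= v Y Yv))

module Valuation (R : CompleteOrderedField) {n : ℕ} (G : Graph n)
                 (l : SetFn R n) (l⊥≡0 : l ⊥ ≡ CompleteOrderedField.0r R) where
  open CompleteOrderedField R
  open OrderedFieldProperties R
  open FiniteSums R
  open Blocks
  open Cuts G
  open CommutativeMonoidSolver +-commutativeMonoid using (solve; _⊕_; _⊜_)

  weight : ∀ {m} → Subset n → (Fin n → Fin m) → ℝ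
  weight Y h = sum (λ j → l (block Y h j))

  θ : ∀ {m} → Subset n → (Fin n → Fin m) → ℝ
  θ Y h = weight Y h - fromℕ (cut Y h)

  sumParts≡weight : ∀ {Y} (P : Partition Y) → sumParts R l P ≡ weight Y (label P)
  sumParts≡weight P = sumF≡sum (k P) _

  Θ≡θ : (P : Partition ⊤) → Θ R G l P ≡ θ ⊤ (label P)
  Θ≡θ P = cong (_- fromℕ (crossing G P)) (sumParts≡weight P)

  l-block-empty : ∀ {m} Y (h : Fin n → Fin m) {j} → (∀ {v} → v ∈ Y → h v ≢ j) →
    l (block Y h j) ≡ 0r
  l-block-empty Y h hv≢j = trans (cong l (block-empty Y h hv≢j)) l⊥≡0

  θ-cong : ∀ {m} {Y} {h h′ : Fin n → Fin m} → (∀ {v} → v ∈ Y → h v ≡ h′ v) → θ Y h ≡ θ Y h′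
  θ-cong {m} {Y} {h} {h′} h≡h′ = cong₂ _-_
    (sum-cong-≗ λ j → cong l (⊆-antisym (block-⊆ {j = j} h≡h′) (block-⊆ {j = j} (sym ∘ h≡h′))))
    (cong fromℕ (cut-cong λ u∈Y v∈Y → cong₂ (λ a b → ⌊ a ≟ b ⌋) (h≡h′ u∈Y) (h≡h′ v∈Y)))
    where
    block-⊆ : ∀ {g g′ : Fin n → Fin m} {j} → (∀ {v} → v ∈ Y → g v ≡ g′ v) →
      block Y g j ⊆ block Y g′ j
    block-⊆ {g} g≡g′ v∈B =
      let (v∈Y , gv≡j) = ∈-block⁻ Y g v∈B in ∈-block⁺ v∈Y (trans (sym (g≡g′ v∈Y)) gv≡j)

  θ-relabel : ∀ {m m′} Y (f : Fin m → Fin m′) → Injective _≡_ _≡_ f → (h : Fin n → Fin m) →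
    θ Y (f ∘ h) ≡ θ Y h
  θ-relabel Y f f-inj h = cong₂ _-_ weight-eq
    (cong fromℕ (cut-cong {Y = Y} {h = f ∘ h} {h′ = h} λ {u} {v} _ _ → ⌊f≟f⌋ {h u} {h v}))
    where
    ⌊f≟f⌋ : ∀ {x y} → ⌊ f x ≟ f y ⌋ ≡ ⌊ x ≟ y ⌋
    ⌊f≟f⌋ {x} {y} = ⌊⌋-⇔ (mk⇔ f-inj (cong f)) (f x ≟ f y) (x ≟ y)
    weight-eq : weight Y (f ∘ h) ≡ weight Y h
    weight-eq = begin
      sum (λ j → l (block Y (f ∘ h) j))
        ≡⟨ ∑-reindex-injective f f-inj (λ j → l (block Y (f ∘ h) j))
             (λ j j∉f → l-block-empty Y (f ∘ h) λ {v} _ → j∉f (h v)) ⟩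
      sum (λ i → l (block Y (f ∘ h) (f i)))
        ≡⟨ sum-cong-≗ (λ i → cong l (tabulate-cong λ v → cong (lookup Y v ∧_) (⌊f≟f⌋ {h v} {i}))) ⟩
      weight Y h ∎
      where open ≡-Reasoning

  θ-const : ∀ {m} {Y} {h : Fin n → Fin m} c → (∀ {v} → v ∈ Y → h v ≡ c) → θ Y h ≡ l Y
  θ-const {Y = Y} {h} c h≡c = begin
    weight Y h - fromℕ (cut Y h)  ≡⟨ cong₂ _-_ weight≡lY (cong fromℕ (countE-false (edges G) uncut)) ⟩
    l Y - 0r                      ≡⟨ cong (l Y +_) -0#≈0# ⟩
    l Y + 0r                      ≡⟨ +-identityʳ (l Y) ⟩
    l Y                           ∎
    where
    open ≡-Reasoning
    weight≡lY : weight Y h ≡ l Y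
    weight≡lY =
      trans (sum-single c (λ j j≢c → l-block-empty Y h λ v∈Y hv≡j → j≢c (trans (sym hv≡j) (h≡c v∈Y))))
            (cong l (⊆-antisym (proj₁ ∘ ∈-block⁻ Y h) (λ v∈Y → ∈-block⁺ v∈Y (h≡c v∈Y))))
    uncut : ∀ u v → lookup Y u ∧ lookup Y v ∧ not ⌊ h u ≟ h v ⌋ ≡ false
    uncut u v with lookup Y u in Yu | lookup Y v in Yv
    ... | false | _     = refl
    ... | true  | false = refl
    ... | true  | true  = cong not (⌊⌋-true (h u ≟ h v)
                            (trans (h≡c (lookup⇒[]= u Y Yu)) (sym (h≡c (lookup⇒[]= v Y Yv)))))

  module _ {K M} (Y : Subset n) {p : Fin n → Fin K} {q : Fin n → Fin M} (q⊑p : q Refines p) where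

    weight-refine : sum (λ j → weight (block Y p j) q) ≡ weight Y q
    weight-refine = trans (∑-comm (λ j i → l (block (block Y p j) q i))) (sum-cong-≗ fibre)
      where
      fibre : ∀ i → sum (λ j → l (block (block Y p j) q i)) ≡ l (block Y q i)
      fibre i with nonempty? (block Y q i)
      ... | no empty =
        trans (sum-zero λ j → l-block-empty (block Y p j) q λ v∈Bⱼ qv≡i →
                 empty (_ , ∈-block⁺ (proj₁ (∈-block⁻ Y p v∈Bⱼ)) qv≡i))
              (sym (trans (cong l (Empty-unique empty)) l⊥≡0))
      ... | yes (w , w∈) = trans (sum-single (p w) others) (cong l (⊆-antisym ⊆B ⊇B))
        where
        qw≡i : q w ≡ i
        qw≡i = proj₂ (∈-block⁻ Y q w∈)
        others : ∀ j → j ≢ p w → l (block (block Y p j) q i) ≡ 0r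
        others j j≢pw = l-block-empty (block Y p j) q λ v∈Bⱼ qv≡i →
          j≢pw (trans (sym (proj₂ (∈-block⁻ Y p v∈Bⱼ))) (q⊑p _ w (trans qv≡i (sym qw≡i))))
        ⊆B : block (block Y p (p w)) q i ⊆ block Y q i
        ⊆B v∈ = let (v∈B , qv≡i) = ∈-block⁻ (block Y p (p w)) q v∈ in
          ∈-block⁺ (proj₁ (∈-block⁻ Y p v∈B)) qv≡i
        ⊇B : block Y q i ⊆ block (block Y p (p w)) q i
        ⊇B v∈ = let (v∈Y , qv≡i) = ∈-block⁻ Y q v∈ in
          ∈-block⁺ (∈-block⁺ v∈Y (q⊑p _ w (trans qv≡i (sym qw≡i)))) qv≡i

    crossesInsideBlock : Fin n → Fin n → Bool
    crossesInsideBlock u v = lookup Y u ∧ lookup Y v ∧ ⌊ p u ≟ p v ⌋ ∧ not ⌊ q u ≟ q v ⌋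

    cut-refine : cut Y q ≡ cut Y p ℕ.+ countE crossesInsideBlock (edges G)
    cut-refine = countE-+ (edges G) split
      where
      split : ∀ u v → 𝟙 (lookup Y u ∧ lookup Y v ∧ not ⌊ q u ≟ q v ⌋)
                    ≡ 𝟙 (lookup Y u ∧ lookup Y v ∧ not ⌊ p u ≟ p v ⌋) ℕ.+ 𝟙 (crossesInsideBlock u v)
      split u v with lookup Y u | lookup Y v
      ... | false | _     = refl
      ... | true  | false = refl
      ... | true  | true  with p u ≟ p v
      ...   | yes _    = refl
      ...   | no pu≢pv rewrite ⌊⌋-false (q u ≟ q v) (pu≢pv ∘ q⊑p u v) = refl

    ∑-cut-blocks : sum (λ j → fromℕ (cut (block Y p j) q)) ≡ fromℕ (countE crossesInsideBlock (edges G))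
    ∑-cut-blocks = ∑-fromℕ-countE crossesIn crossesInsideBlock (edges G) λ u v →
      trans (sum-single (p u) (others u v)) (cong (fromℕ ∘ 𝟙) (at-pu u v))
      where
      crossesIn : Fin K → Fin n → Fin n → Bool
      crossesIn j u v = lookup (block Y p j) u ∧ lookup (block Y p j) v ∧ not ⌊ q u ≟ q v ⌋
      others : ∀ u v j → j ≢ p u → fromℕ (𝟙 (crossesIn j u v)) ≡ 0r
      others u v j j≢pu = cong (λ b → fromℕ (𝟙 (b ∧ lookup (block Y p j) v ∧ not ⌊ q u ≟ q v ⌋))) (begin
        lookup (block Y p j) u    ≡⟨ lookup∘tabulate _ u ⟩
        lookup Y u ∧ ⌊ p u ≟ j ⌋  ≡⟨ cong (lookup Y u ∧_) (⌊⌋-false (p u ≟ j) (j≢pu ∘ sym)) ⟩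
        lookup Y u ∧ false        ≡⟨ ∧-zeroʳ (lookup Y u) ⟩
        false                     ∎)
        where open ≡-Reasoning
      at-pu : ∀ u v → crossesIn (p u) u v ≡ crossesInsideBlock u v
      at-pu u v = begin
        lookup (block Y p (p u)) u ∧ lookup (block Y p (p u)) v ∧ X
          ≡⟨ cong₂ (λ a b → a ∧ b ∧ X) (lookup∘tabulate _ u) (lookup∘tabulate _ v) ⟩
        (lookup Y u ∧ ⌊ p u ≟ p u ⌋) ∧ (lookup Y v ∧ ⌊ p v ≟ p u ⌋) ∧ X
          ≡⟨ cong₂ (λ a b → (lookup Y u ∧ a) ∧ (lookup Y v ∧ b) ∧ X)
                   (⌊⌋-true (p u ≟ p u) refl) (⌊⌋-⇔ (mk⇔ sym sym) (p v ≟ p u) (p u ≟ p v)) ⟩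
        (lookup Y u ∧ true) ∧ (lookup Y v ∧ ⌊ p u ≟ p v ⌋) ∧ X
          ≡⟨ cong₂ _∧_ (∧-identityʳ (lookup Y u)) (∧-assoc (lookup Y v) _ X) ⟩
        crossesInsideBlock u v ∎
        where
        open ≡-Reasoning
        X : Bool
        X = not ⌊ q u ≟ q v ⌋

    θ-refine : θ Y q ≡ sum (λ j → θ (block Y p j) q) - fromℕ (cut Y p)
    θ-refine = begin
      weight Y q - fromℕ (cut Y q)
        ≡⟨ cong (λ x → weight Y q - x) (trans (cong fromℕ cut-refine) (fromℕ-+ (cut Y p) _)) ⟩
      weight Y q - (c + s)
        ≡⟨ cong (weight Y q +_) (-‿+-comm c s) ⟨
      weight Y q + (- c + - s)
        ≡⟨ solve 3 (λ w c s → w ⊕ (c ⊕ s) ⊜ (w ⊕ s) ⊕ c) refl (weight Y q) (- c) (- s) ⟩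
      weight Y q - s - c
        ≡⟨ cong₂ (λ w s → w - s - c) weight-refine ∑-cut-blocks ⟨
      sum Wⱼ - sum cⱼ - c
        ≡⟨ cong (λ s → sum Wⱼ + s - c) (∑-distrib-neg cⱼ) ⟨
      sum Wⱼ + sum (λ j → - cⱼ j) - c
        ≡⟨ cong (_- c) (∑-distrib-+ Wⱼ (λ j → - cⱼ j)) ⟨
      sum (λ j → θ (block Y p j) q) - c ∎
      where
      open ≡-Reasoning
      c s : ℝ
      c = fromℕ (cut Y p)
      s = fromℕ (countE crossesInsideBlock (edges G))
      Wⱼ cⱼ : Fin K → ℝ
      Wⱼ j = weight (block Y p j) q
      cⱼ j = fromℕ (cut (block Y p j) q)

  module _ {K L} (p : Fin n → Fin K) (i : Fin K) (ω : Fin n → Fin L) where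

    splitLabel : Fin n → Fin K ⊎ Fin L
    splitLabel v with p v ≟ i
    ... | yes _ = inj₂ (ω v)
    ... | no  _ = inj₁ (p v)

    splitBlock : Fin n → Fin (K ℕ.+ L)
    splitBlock = join K L ∘ splitLabel

    splitLabel-inside : ∀ {v} → p v ≡ i → splitLabel v ≡ inj₂ (ω v)
    splitLabel-inside {v} pv≡i with p v ≟ i
    ... | yes _   = refl
    ... | no pv≢i = ⊥-elim (pv≢i pv≡i)

    splitLabel-outside : ∀ {v} → p v ≢ i → splitLabel v ≡ inj₁ (p v)
    splitLabel-outside {v} pv≢i with p v ≟ i
    ... | yes pv≡i = ⊥-elim (pv≢i pv≡i)
    ... | no _     = refl

    splitBlock-refines : splitBlock Refines p
    splitBlock-refines u v su≡sv = refines (join-injective K L su≡sv)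
      where
      refines : splitLabel u ≡ splitLabel v → p u ≡ p v
      refines same with p u ≟ i | p v ≟ i
      ... | yes pu≡i | yes pv≡i = trans pu≡i (sym pv≡i)
      ... | yes _    | no _     with () ← same
      ... | no _     | yes _    with () ← same
      ... | no _     | no _     = inj₁-injective same

    θ-splitBlock : ∀ Y → let B = block Y p i in θ Y splitBlock + l B ≡ θ Y p + θ B ω
    θ-splitBlock Y = begin
      θ Y splitBlock + l B
        ≡⟨ cong (_+ l B) (θ-refine Y splitBlock-refines) ⟩
      sum θⱼ - c + l B
        ≡⟨ solve 3 (λ s c b → (s ⊕ c) ⊕ b ⊜ (s ⊕ b) ⊕ c) refl (sum θⱼ) (- c) (l B) ⟩
      sum θⱼ + l B - c
        ≡⟨ cong (_- c) (sum-update i outside) ⟩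
      weight Y p + θ B splitBlock - c
        ≡⟨ solve 3 (λ w t c → (w ⊕ t) ⊕ c ⊜ (w ⊕ c) ⊕ t) refl (weight Y p) (θ B splitBlock) (- c) ⟩
      θ Y p + θ B splitBlock
        ≡⟨ cong (θ Y p +_) inside ⟩
      θ Y p + θ B ω ∎
      where
      open ≡-Reasoning
      B : Subset n
      B = block Y p i
      c : ℝ
      c = fromℕ (cut Y p)
      θⱼ : Fin K → ℝ
      θⱼ j = θ (block Y p j) splitBlock
      outside : ∀ j → j ≢ i → θⱼ j ≡ l (block Y p j)
      outside j j≢i = θ-const (join K L (inj₁ j)) λ v∈Bⱼ →
        let pv≡j = proj₂ (∈-block⁻ Y p v∈Bⱼ) in
        trans (cong (join K L) (splitLabel-outside (λ pv≡i → j≢i (trans (sym pv≡j) pv≡i))))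
              (cong (join K L ∘ inj₁) pv≡j)
      inside : θ B splitBlock ≡ θ B ω
      inside =
        trans (θ-cong {Y = B} (λ v∈B → cong (join K L) (splitLabel-inside (proj₂ (∈-block⁻ Y p v∈B)))))
              (θ-relabel B (join K L ∘ inj₂) (inj₂-injective ∘ join-injective K L) ω)

  θ-removeEmptyBlock : ∀ {m} {Y} → (Fin n → Nonempty Y) →
    (h : Fin n → Fin (suc m)) (j : Fin (suc m)) → Empty (block Y h j) →
    ∃ λ (h′ : Fin n → Fin m) → θ Y h′ ≡ θ Y h
  θ-removeEmptyBlock {m} {Y} inhabited h j empty =
    h′ , trans (sym (θ-relabel Y (punchIn j) (punchIn-injective j _ _) h′)) (θ-cong punchIn-h′)
    where
    hv≢j : ∀ {v} → v ∈ Y → h v ≢ j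
    hv≢j v∈Y hv≡j = empty (_ , ∈-block⁺ v∈Y hv≡j)
    h′ : Fin n → Fin m
    h′ v with h v ≟ j
    ... | no hv≢j′ = punchOut (hv≢j′ ∘ sym)
    ... | yes _    = punchOut (hv≢j (proj₂ (inhabited v)) ∘ sym)
    punchIn-h′ : ∀ {v} → v ∈ Y → punchIn j (h′ v) ≡ h v
    punchIn-h′ {v} v∈Y with h v ≟ j
    ... | no hv≢j′ = punchIn-punchOut (hv≢j′ ∘ sym)
    ... | yes hv≡j = ⊥-elim (hv≢j v∈Y hv≡j)

  -- Partition Y is empty when Y is empty but n is not, hence the hypothesis on Y.
  normalise : ∀ {m} {Y} → (Fin n → Nonempty Y) → (h : Fin n → Fin m) →
    ∃ λ (P : Partition Y) → θ Y (label P) ≡ θ Y h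
  normalise {zero} _ h = record { k = 0 ; label = h ; partNonempty = λ () } , refl
  normalise {suc m} {Y} inhabited h with all? (λ j → nonempty? (block Y h j))
  ... | yes nonempty = record { k = suc m ; label = h ; partNonempty = nonempty } , refl
  ... | no ¬nonempty =
    let (j , empty)   = ¬∀⟶∃¬ (suc m) _ (λ j → nonempty? (block Y h j)) ¬nonempty
        (h′ , θh′≡θh) = θ-removeEmptyBlock inhabited h j empty
        (P , θP≡θh′)  = normalise inhabited h′
    in P , trans θP≡θh′ θh′≡θh

  θ-maximum : ∃ λ (g : Fin n → Fin (suc n)) → ∀ {m} (h : Fin n → Fin m) → θ ⊤ h ≤ θ ⊤ g
  θ-maximum = g , bound
    where
    open Maximisation totalOrder using (argmax-→)
    maximiser : ∃ λ (g : Fin n → Fin (suc n)) → ∀ g′ → θ ⊤ g′ ≤ θ ⊤ g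
    maximiser = argmax-→ (θ ⊤) (λ g≗g′ → θ-cong {Y = ⊤} (λ {v} _ → g≗g′ v))
    g : Fin n → Fin (suc n)
    g = proj₁ maximiser
    bound : ∀ {m} (h : Fin n → Fin m) → θ ⊤ h ≤ θ ⊤ g
    bound h = subst (_≤ θ ⊤ g) (trans θ-embedded θP≡θh) (proj₂ maximiser (embed ∘ label P))
      where
      P : Partition ⊤
      P = proj₁ (normalise (λ v → v , ∈⊤) h)
      θP≡θh : θ ⊤ (label P) ≡ θ ⊤ h
      θP≡θh = proj₂ (normalise (λ v → v , ∈⊤) h)
      k≤1+n : k P ℕ.≤ suc n
      k≤1+n = ℕ.m≤n⇒m≤1+n (parts≤n P)
      embed : Fin (k P) → Fin (suc n)
      embed i = inject≤ i k≤1+n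
      θ-embedded : θ ⊤ (embed ∘ label P) ≡ θ ⊤ (label P)
      θ-embedded = θ-relabel ⊤ embed (inject≤-injective k≤1+n k≤1+n _ _) (label P)

  connected⇒θ≤l : ∀ {Y} → PartitionConnectedOn R G l Y → (Fin n → Nonempty Y) →
    ∀ {m} (h : Fin n → Fin m) → θ Y h ≤ l Y
  connected⇒θ≤l {Y} connected inhabited h = subst (_≤ l Y) θP≡θh (x-y≤z⇒x-z≤y (connected P))
    where
    P : Partition Y
    P = proj₁ (normalise inhabited h)
    θP≡θh : sumParts R l P - fromℕ (crossing G P) ≡ θ Y h
    θP≡θh = trans (cong (_- fromℕ (crossing G P)) (sumParts≡weight P)) (proj₂ (normalise inhabited h))

  θ≤l⇒connected : ∀ {Y} → (∀ (P : Partition Y) → θ Y (label P) ≤ l Y) → PartitionConnectedOn R G l Y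
  θ≤l⇒connected {Y} θ≤lY P = x-y≤z⇒x-z≤y
    (subst (_≤ l Y) (cong (_- fromℕ (crossing G P)) (sym (sumParts≡weight P))) (θ≤lY P))

  maximiser-blocks-connected : ∀ {m} (g : Fin n → Fin m) →
    (∀ {m′} (h : Fin n → Fin m′) → θ ⊤ h ≤ θ ⊤ g) → ∀ i → PartitionConnectedOn R G l (block ⊤ g i)
  maximiser-blocks-connected g g-max i = θ≤l⇒connected λ Ω →
    +-cancelˡ-≤ (θ ⊤ g) (subst (_≤ θ ⊤ g + l (block ⊤ g i)) (θ-splitBlock g i (label Ω) ⊤)
      (+-mono-≤ (l (block ⊤ g i)) (g-max (splitBlock g i (label Ω)))))

  θ≤Θ : ∀ (P : Partition ⊤) → IsComponentPartition R G l P →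
    ∀ {m} (h : Fin n → Fin m) → θ ⊤ h ≤ Θ R G l P
  θ≤Θ P (connected , maximal) h = ≤-trans (g-max h) θg≤Θ
    where
    g : Fin n → Fin (suc n)
    g = proj₁ θ-maximum
    g-max : ∀ {m} (h : Fin n → Fin m) → θ ⊤ h ≤ θ ⊤ g
    g-max = proj₂ θ-maximum
    g-refines : g Refines label P
    g-refines u v gu≡gv =
      trans (label-in (∈-block⁺ ∈⊤ refl)) (sym (label-in (∈-block⁺ ∈⊤ (sym gu≡gv))))
      where
      inPart : ∃ λ j → block ⊤ g (g u) ⊆ part P j
      inPart = maximal (block ⊤ g (g u)) (u , ∈-block⁺ ∈⊤ refl)
                       (maximiser-blocks-connected g g-max (g u))
      label-in : ∀ {w} → w ∈ block ⊤ g (g u) → label P w ≡ proj₁ inPart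
      label-in w∈ = proj₂ (∈-block⁻ ⊤ (label P) (proj₂ inPart w∈))
    θg≤Θ : θ ⊤ g ≤ Θ R G l P
    θg≤Θ = subst₂ _≤_ (sym (θ-refine ⊤ g-refines)) (sym (Θ≡θ P))
      (+-mono-≤ (- fromℕ (crossing G P))
        (sum-mono-≤ λ j → connected⇒θ≤l (connected j) (λ _ → partNonempty P j) g))

mainTheorem3 : (R : CompleteOrderedField) → let open CompleteOrderedField R in
    ∀ {n : ℕ} (G : Graph n) (l : SetFn R n) →
    l ⊥ ≡ 0r → IntersectingSupermodular R l →
    (β : ℝ) → 1r ≤ β →
    (P : Partition {n} ⊤) → IsComponentPartition R G l P →
    (Q : Partition {n} ⊤) → IsComponentPartition R G (scale R β l) Q →
    (l ⊤ ≤ Θ R G l P) ×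
    (Θ R G l P ≤ (β ⁻¹) * Θ R G (scale R β l) Q) ×
    (PartitionConnected R G l ⇔ (Θ R G l P ≡ l ⊤))
mainTheorem3 R G l l⊥≡0 _ β 1≤β P P-components Q Q-components =
  l⊤≤Θ , Θ≤β⁻¹Θβl , mk⇔ connected⇒Θ≡l Θ≡l⇒connected
  where
  open CompleteOrderedField R
  open OrderedFieldProperties R
  open FiniteSums R using (sumF≡sum; *-distribˡ-sum)
  open Valuation R G l l⊥≡0
  module βl = Valuation R G (scale R β l) (trans (cong (β *_) l⊥≡0) (zeroʳ β))

  l⊤≤Θ : l ⊤ ≤ Θ R G l P
  l⊤≤Θ = subst (_≤ Θ R G l P) (θ-const {Y = ⊤} (zero {0}) (λ _ → refl))
               (θ≤Θ P P-components (λ _ → zero {0}))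

  Θ≤β⁻¹Θβl : Θ R G l P ≤ β ⁻¹ * Θ R G (scale R β l) Q
  Θ≤β⁻¹Θβl = x⁻¹-scaling 1≤β (fromℕ-nonneg (crossing G P))
    (subst (_≤ Θ R G (scale R β l) Q) βθ≡ (βl.θ≤Θ Q Q-components (label P)))
    where
    βθ≡ : βl.θ ⊤ (label P) ≡ β * sumParts R l P - fromℕ (crossing G P)
    βθ≡ = cong (_- fromℕ (crossing G P))
               (trans (sym (*-distribˡ-sum β (λ j → l (part P j))))
                      (cong (β *_) (sym (sumF≡sum (k P) (λ j → l (part P j))))))

  connected⇒Θ≡l : PartitionConnected R G l → Θ R G l P ≡ l ⊤
  connected⇒Θ≡l connected = antisym (x-y≤z⇒x-z≤y (connected P)) l⊤≤Θ

  Θ≡l⇒connected : Θ R G l P ≡ l ⊤ → PartitionConnected R G l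
  Θ≡l⇒connected Θ≡l = θ≤l⇒connected λ P′ →
    subst (θ ⊤ (label P′) ≤_) Θ≡l (θ≤Θ P P-components (label P′))
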